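{- For all $f,g\in\Bbbk[x,\theta]$, we have $f\odot\star g=\star(f\cdot g)$, where $\star$ is the Hodge dual.
   Context: $\Bbbk\subseteq\mathbb{C}$ is a subfield stable under complex conjugation. $\Bbbk[x,\theta]$ is the algebra generated by commuting $x_1,\dots,x_n$ and pairwise anticommuting $\theta_1,\dots,\theta_n$ (commuting with the $x_j$); $\Bbbk[x,\psi]$ likewise with $\psi_i$. For $I=\{i_1<\cdots<i_r\}\subseteq[n]$, $\theta_I=\theta_{i_1}\cdots\theta_{i_r}$, similarly $\psi_I$. Operators: $\partial_i^x=\partial/\partial x_i$; $m_i^\psi$ = left multiplication by $\psi_i$; $\partial_i^\theta$ is the $\Bbbk[x]$-linear map with $\partial_i^\theta(\theta_{i_1}\cdots\theta_{i_r})=(-1)^{m-1}\theta_{i_1}\cdots\widehat{\theta_{i_m}}\cdots\theta_{i_r}$ if $i=i_m$, and $0$ if $i\notin\{i_1,\dots,i_r\}$. Actions: $f\cdot g=\overline{f}(\partial_1^x,\dots,\partial_n^x,\partial_1^\theta,\dots,\partial_n^\theta)(g)$ on $\Bbbk[x,\theta]$ and $f\odot h=\overline{f}(\partial_1^x,\dots,\partial_n^x,m_1^\psi,\dots,m_n^\psi)(h)$ for $h\in\Bbbk[x,\psi]$, with $\overline f$ the coefficientwise complex conjugate. The Hodge dual is the $\Bbbk[x]$-linear map $\star:\Bbbk[x,\theta]\to\Bbbk[x,\psi]$ with $\star\theta_I=(-1)^{\deg(I)}\psi_J$, where $J=[n]\setminus I$ and $\deg(I)=\sum_{i\in I}(i-1)$.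 -}

module Defs where

open import Level using (Level; _⊔_)
open import Algebra.Bundles using (CommutativeRing)
open import Data.Nat as ℕ using (ℕ; zero; suc; _≡ᵇ_)
open import Data.Bool using (Bool; true; false; if_then_else_)
open import Data.Fin using (Fin; toℕ) renaming (zero to fz; suc to fs)
open import Data.Fin.Subset using (Subset; ∁)
open import Data.Vec as Vec using (Vec; []; _∷_; lookup; _[_]%=_; _[_]≔_)
open import Data.Vec.Properties using (≡-dec)
open import Data.List as List using (List; []; _∷_; foldr; concatMap; allFin)
open import Data.Product using (_×_; _,_)
open import Data.Product.Properties using () renaming (≡-dec to ×-≡-dec)
open import Data.Bool.Properties using () renaming (_≟_ to _≟ᵇ_)
open import Data.Nat.Properties using () renaming (_≟_ to _≟ℕ_)
open import Data.Nat.ListAction using (sum)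
open import Relation.Nullary using (¬_)
open import Relation.Nullary.Decidable using (⌊_⌋)
open import Relation.Binary.PropositionalEquality using (_≡_)

fromℕ : ∀ {c ℓ} (R : CommutativeRing c ℓ) → ℕ → CommutativeRing.Carrier R
fromℕ R zero    = CommutativeRing.0# R
fromℕ R (suc k) = CommutativeRing._+_ R (CommutativeRing.1# R) (fromℕ R k)

record ConjField c ℓ : Set (Level.suc (c ⊔ ℓ)) where
  field
    ringK : CommutativeRing c ℓ
  open CommutativeRing ringK public hiding (ring)
  field
    1≉0     : ¬ (1# ≈ 0#)
    inverse : ∀ x → ¬ (x ≈ 0#) → Data.Product.Σ Carrier (λ y → x * y ≈ 1#)
    char0   : ∀ k → fromℕ ringK k ≈ 0# → k ≡ 0
    conj        : Carrier → Carrier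
    conj-cong   : ∀ {x y} → x ≈ y → conj x ≈ conj y
    conj-+      : ∀ x y → conj (x + y) ≈ conj x + conj y
    conj-*      : ∀ x y → conj (x * y) ≈ conj x * conj y
    conj-1      : conj 1# ≈ 1#
    conj-invol  : ∀ x → conj (conj x) ≈ x

module Super {c ℓ} (K : ConjField c ℓ) where
  open ConjField K

  sign : ℕ → Carrier
  sign zero    = 1#
  sign (suc k) = - sign k

  -- A term  c · x^a · θ_J  (resp. c · x^a · ψ_J); the odd variables are
  -- indexed by Fin n (θ_{i+1} in the paper is index i here), and J is the
  -- subset of odd variables occurring, multiplied in increasing order.
  Term : ℕ → Set c
  Term n = Carrier × Vec ℕ n × Subset n

  Poly : ℕ → Set c
  Poly n = List (Term n)

  coeff : ∀ {n} → Poly n → Vec ℕ n → Subset n → Carrier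
  coeff p a J = foldr step 0# p
    where
    step : _ → Carrier → Carrier
    step (c , b , K) s =
      (if ⌊ ×-≡-dec (≡-dec _≟ℕ_) (≡-dec _≟ᵇ_) (b , K) (a , J) ⌋ then c else 0#) + s

  _≋_ : ∀ {n} → Poly n → Poly n → Set ℓ
  p ≋ q = ∀ a J → coeff p a J ≈ coeff q a J

  members : ∀ {n} → Subset n → List (Fin n)
  members []          = []
  members (true ∷ I)  = fz ∷ List.map fs (members I)
  members (false ∷ I) = List.map fs (members I)

  below : ∀ {n} → Subset n → Fin n → ℕ
  below (b ∷ J) fz     = 0
  below (b ∷ J) (fs i) = (if b then 1 else 0) ℕ.+ below J i

  -- deg(I) = Σ_{i ∈ I} (i - 1) (1-indexed) = Σ_{i ∈ I} toℕ i (0-indexed)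
  deg : ∀ {n} → Subset n → ℕ
  deg I = sum (List.map toℕ (members I))

  scale : ∀ {n} → Carrier → Term n → Term n
  scale d (c , a , J) = (d * c , a , J)

  ∂x : ∀ {n} → Fin n → Term n → Term n
  ∂x i (c , a , J) = (fromℕ ringK (lookup a i) * c , a [ i ]%= ℕ.pred , J)

  -- ∂^θ_i on a term: θ_{i_1}⋯θ_{i_r} ↦ (-1)^{m-1} (θ_{i_m} removed) if i = i_m
  ∂θ : ∀ {n} → Fin n → Term n → Term n
  ∂θ i (c , a , J) with lookup J i
  ... | true  = (sign (below J i) * c , a , J [ i ]≔ false)
  ... | false = (0# , a , J)

  -- m^ψ_i on a term: left multiplication by ψ_i
  mψ : ∀ {n} → Fin n → Term n → Term n
  mψ i (c , a , J) with lookup J i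
  ... | true  = (0# , a , J)
  ... | false = (sign (below J i) * c , a , J [ i ]≔ true)

  iter : ∀ {A : Set c} → ℕ → (A → A) → A → A
  iter zero    f t = t
  iter (suc k) f t = f (iter k f t)

  ∂xs : ∀ {n} → Vec ℕ n → Term n → Term n
  ∂xs {n} a t = foldr (λ i s → iter (lookup a i) (∂x i) s) t (allFin n)

  -- substituting operators op_{i} into θ_{i_1}⋯θ_{i_r}: op_{i_1} ∘ ⋯ ∘ op_{i_r}
  oddOps : ∀ {n} → (Fin n → Term n → Term n) → Subset n → Term n → Term n
  oddOps op I t = foldr op t (members I)

  -- f̄(∂^x, op) applied to g
  act : ∀ {n} → (Fin n → Term n → Term n) → Poly n → Poly n → Poly n
  act op f g = concatMap (λ { (c , a , I) →
                 List.map (λ t → scale (conj c) (∂xs a (oddOps op I t))) g }) f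

  _·_ : ∀ {n} → Poly n → Poly n → Poly n
  f · g = act ∂θ f g

  _⊙_ : ∀ {n} → Poly n → Poly n → Poly n
  f ⊙ h = act mψ f h

  ⋆ : ∀ {n} → Poly n → Poly n
  ⋆ = List.map (λ { (c , a , I) → (sign (deg I) * c , a , ∁ I) })

-- The Hodge dual intertwines every operator out of which the two actions are
-- built: it commutes with ∂/∂x_i and with scalars, and ⋆ ∘ ∂^θ_i = m^ψ_i ∘ ⋆ on
-- terms. For the last identity, the sign (-1)^#{j ∈ I, j < i} of ∂^θ_i and the
-- sign (-1)^#{j ∉ I, j < i} of m^ψ_i multiply to (-1)^#{j : j < i}, which is
-- exactly the change of (-1)^deg when i is removed from I. Both actions are
-- term-by-term, so f ⊙ ⋆ g and ⋆ (f · g) agree even as lists of terms, up to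
-- equal coefficients.
module Submission where

open import Defs
open import Level using (_⊔_)
open import Data.Nat using (ℕ; zero; suc; _+_)
open import Data.Nat.Properties using (+-suc; +-assoc; +-identityʳ; +-commutativeSemigroup)
open import Data.Nat.Tactic.RingSolver using (solve-∀)
open import Data.Nat.ListAction using (sum)
open import Data.Bool using (true; false; not; if_then_else_)
open import Data.Fin using (Fin; toℕ) renaming (zero to fz; suc to fs)
open import Data.Fin.Subset using (Subset; ∁)
open import Data.Vec using (Vec; _∷_; lookup; _[_]≔_)
open import Data.Vec.Properties using (lookup-map; map-[]≔)
open import Data.List using (List; []; _∷_; length; map; foldr; allFin)
open import Data.List.Properties using (length-map; map-concatMap)
open import Data.List.Relation.Binary.Pointwise as Pointwise using (Pointwise; []; _∷_)
open import Data.Product using (_,_)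
open import Function using (_∘_)
open import Relation.Binary.Core using (_Preserves_⟶_)
open import Relation.Binary.PropositionalEquality as ≡ using (_≡_)
import Algebra.Properties.Ring as RingProperties
import Algebra.Properties.CommutativeSemigroup as CommutativeSemigroupProperties
open import Algebra.Bundles using (CommutativeRing)

module _ {c ℓ} (K : ConjField c ℓ) where
  open Super K using (members; below; deg)
  open CommutativeSemigroupProperties +-commutativeSemigroup using (x∙yz≈y∙xz)
  open ≡.≡-Reasoning

  size : ∀ {n} → Subset n → ℕ
  size J = length (members J)

  sum-map-toℕ-fs : ∀ {n} (is : List (Fin n)) →
                   sum (map toℕ (map fs is)) ≡ length is + sum (map toℕ is)
  sum-map-toℕ-fs []       = ≡.refl
  sum-map-toℕ-fs (i ∷ is) = ≡.cong suc (begin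
    toℕ i + sum (map toℕ (map fs is))      ≡⟨ ≡.cong (toℕ i +_) (sum-map-toℕ-fs is) ⟩
    toℕ i + (length is + sum (map toℕ is)) ≡⟨ x∙yz≈y∙xz (toℕ i) (length is) _ ⟩
    length is + (toℕ i + sum (map toℕ is)) ∎)

  deg-∷ : ∀ {n} b (J : Subset n) → deg (b ∷ J) ≡ size J + deg J
  deg-∷ true  J = sum-map-toℕ-fs (members J)
  deg-∷ false J = sum-map-toℕ-fs (members J)

  size-∷ : ∀ {n} b (J : Subset n) → size (b ∷ J) ≡ (if b then 1 else 0) + size J
  size-∷ true  J = ≡.cong suc (length-map fs (members J))
  size-∷ false J = length-map fs (members J)

  size-remove : ∀ {n} (J : Subset n) i → lookup J i ≡ true →
                size J ≡ suc (size (J [ i ]≔ false))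
  size-remove (true ∷ J) fz     _   = ≡.trans (size-∷ true J) (≡.cong suc (≡.sym (size-∷ false J)))
  size-remove (b ∷ J)    (fs i) i∈J = begin
    size (b ∷ J)                 ≡⟨ size-∷ b J ⟩
    β + size J                   ≡⟨ ≡.cong (β +_) (size-remove J i i∈J) ⟩
    β + suc (size J′)            ≡⟨ +-suc β (size J′) ⟩
    suc (β + size J′)            ≡⟨ ≡.cong suc (size-∷ b J′) ⟨
    suc (size (b ∷ J′))          ∎
    where
    β  = if b then 1 else 0
    J′ = J [ i ]≔ false

  deg-remove : ∀ {n} (J : Subset n) i → lookup J i ≡ true →
               deg J ≡ deg (J [ i ]≔ false) + toℕ i
  deg-remove (true ∷ J) fz     _   = begin
    deg (true ∷ J)      ≡⟨ deg-∷ true J ⟩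
    size J + deg J      ≡⟨ deg-∷ false J ⟨
    deg (false ∷ J)     ≡⟨ +-identityʳ _ ⟨
    deg (false ∷ J) + 0 ∎
  deg-remove (b ∷ J)    (fs i) i∈J = begin
    deg (b ∷ J)                         ≡⟨ deg-∷ b J ⟩
    size J + deg J                      ≡⟨ ≡.cong₂ _+_ (size-remove J i i∈J) (deg-remove J i i∈J) ⟩
    suc (size J′) + (deg J′ + toℕ i)    ≡⟨ ≡.cong suc (+-assoc (size J′) (deg J′) (toℕ i)) ⟨
    suc (size J′ + deg J′ + toℕ i)      ≡⟨ +-suc (size J′ + deg J′) (toℕ i) ⟨
    size J′ + deg J′ + suc (toℕ i)      ≡⟨ ≡.cong (_+ suc (toℕ i)) (deg-∷ b J′) ⟨
    deg (b ∷ J′) + suc (toℕ i)          ∎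
    where J′ = J [ i ]≔ false

  below-+-below-∁ : ∀ {n} (J : Subset n) i → below J i + below (∁ J) i ≡ toℕ i
  below-+-below-∁ (b ∷ J)     fz     = ≡.refl
  below-+-below-∁ (true ∷ J)  (fs i) = ≡.cong suc (below-+-below-∁ J i)
  below-+-below-∁ (false ∷ J) (fs i) =
    ≡.trans (+-suc (below J i) (below (∁ J) i)) (≡.cong suc (below-+-below-∁ J i))

module _ {c ℓ} (K : ConjField c ℓ) where
  open ConjField K hiding (_+_)
  open Super K
  open RingProperties (CommutativeRing.ring ringK) using (-‿involutive; -‿distribˡ-*)
  open CommutativeSemigroupProperties *-commutativeSemigroup using (x∙yz≈y∙xz)
  open import Relation.Binary.Reasoning.Setoid setoid

  sign-*-sign : ∀ m k x → sign m * (sign k * x) ≈ sign (m + k) * x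
  sign-*-sign zero    k x = *-identityˡ _
  sign-*-sign (suc m) k x = begin
    - sign m * (sign k * x)    ≈⟨ -‿distribˡ-* _ _ ⟨
    - (sign m * (sign k * x))  ≈⟨ -‿cong (sign-*-sign m k x) ⟩
    - (sign (m + k) * x)       ≈⟨ -‿distribˡ-* _ _ ⟩
    - sign (m + k) * x         ∎

  sign-double-+ : ∀ k m → sign (k + k + m) ≈ sign m
  sign-double-+ zero    m = refl
  sign-double-+ (suc k) m = begin
    sign (suc k + suc k + m)  ≡⟨ ≡.cong (λ j → sign (suc (j + m))) (+-suc k k) ⟩
    - - sign (k + k + m)      ≈⟨ -‿involutive _ ⟩
    sign (k + k + m)          ≈⟨ sign-double-+ k m ⟩
    sign m                    ∎

  sign-remove : ∀ {n} (J : Subset n) i x → lookup J i ≡ true →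
                sign (below (∁ J) i) * (sign (deg J) * x) ≈
                sign (deg (J [ i ]≔ false)) * (sign (below J i) * x)
  sign-remove J i x i∈J = begin
    sign b̄ * (sign (deg J) * x)   ≈⟨ sign-*-sign b̄ (deg J) x ⟩
    sign (b̄ + deg J) * x          ≡⟨ ≡.cong (λ k → sign k * x) parity ⟨
    sign (b̄ + b̄ + (d′ + b)) * x   ≈⟨ *-congʳ (sign-double-+ b̄ (d′ + b)) ⟩
    sign (d′ + b) * x             ≈⟨ sign-*-sign d′ b x ⟨
    sign d′ * (sign b * x)        ∎
    where
    d′ = deg (J [ i ]≔ false)
    b  = below J i
    b̄  = below (∁ J) i
    rearrange : ∀ u v w → u + u + (v + w) ≡ u + (v + (w + u))
    rearrange = solve-∀
    parity : b̄ + b̄ + (d′ + b) ≡ b̄ + deg J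
    parity = ≡.trans (rearrange b̄ d′ b) (≡.cong (b̄ +_) (≡.sym (≡.trans
               (deg-remove K J i i∈J) (≡.cong (d′ +_) (≡.sym (below-+-below-∁ K J i))))))

  infix 4 _≈ₜ_
  data _≈ₜ_ {n} : Term n → Term n → Set (c ⊔ ℓ) where
    coeff-≈ : ∀ {x y a J} → x ≈ y → (x , a , J) ≈ₜ (y , a , J)

  ≈ₜ-refl : ∀ {n} {t : Term n} → t ≈ₜ t
  ≈ₜ-refl = coeff-≈ refl

  ≈ₜ-trans : ∀ {n} {t u v : Term n} → t ≈ₜ u → u ≈ₜ v → t ≈ₜ v
  ≈ₜ-trans (coeff-≈ x≈y) (coeff-≈ y≈z) = coeff-≈ (trans x≈y y≈z)

  ⋆ₜ : ∀ {n} → Term n → Term n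
  ⋆ₜ (x , a , I) = (sign (deg I) * x , a , ∁ I)

  Intertwined : ∀ {n} → (Term n → Term n) → (Term n → Term n) → Set (c ⊔ ℓ)
  Intertwined F G = ∀ t → G (⋆ₜ t) ≈ₜ ⋆ₜ (F t)

  ∘-intertwined : ∀ {n} {F F′ G G′ : Term n → Term n} → G Preserves _≈ₜ_ ⟶ _≈ₜ_ →
                  Intertwined F G → Intertwined F′ G′ → Intertwined (F ∘ F′) (G ∘ G′)
  ∘-intertwined G-cong F⋆G F′⋆G′ t = ≈ₜ-trans (G-cong (F′⋆G′ t)) (F⋆G _)

  iter-cong : ∀ {n} {G : Term n → Term n} → G Preserves _≈ₜ_ ⟶ _≈ₜ_ →
              ∀ k → iter k G Preserves _≈ₜ_ ⟶ _≈ₜ_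
  iter-cong G-cong zero    t≈u = t≈u
  iter-cong G-cong (suc k) t≈u = G-cong (iter-cong G-cong k t≈u)

  iter-intertwined : ∀ {n} {F G : Term n → Term n} → G Preserves _≈ₜ_ ⟶ _≈ₜ_ →
                     Intertwined F G → ∀ k → Intertwined (iter k F) (iter k G)
  iter-intertwined G-cong F⋆G zero    t = ≈ₜ-refl
  iter-intertwined {F = F} {G} G-cong F⋆G (suc k) =
    ∘-intertwined {F = F} {iter k F} {G} {iter k G} G-cong F⋆G (iter-intertwined G-cong F⋆G k)

  foldr-cong : ∀ {a n} {A : Set a} {G : A → Term n → Term n} →
               (∀ x → G x Preserves _≈ₜ_ ⟶ _≈ₜ_) →
               ∀ xs → (λ t → foldr G t xs) Preserves _≈ₜ_ ⟶ _≈ₜ_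
  foldr-cong G-cong []       t≈u = t≈u
  foldr-cong G-cong (x ∷ xs) t≈u = G-cong x (foldr-cong G-cong xs t≈u)

  foldr-intertwined : ∀ {a n} {A : Set a} {F G : A → Term n → Term n} →
                      (∀ x → G x Preserves _≈ₜ_ ⟶ _≈ₜ_) → (∀ x → Intertwined (F x) (G x)) →
                      ∀ xs → Intertwined (λ t → foldr F t xs) (λ t → foldr G t xs)
  foldr-intertwined G-cong F⋆G []       t = ≈ₜ-refl
  foldr-intertwined {F = F} {G} G-cong F⋆G (x ∷ xs) =
    ∘-intertwined {F = F x} {λ t → foldr F t xs} {G x} {λ t → foldr G t xs}
      (G-cong x) (F⋆G x) (foldr-intertwined G-cong F⋆G xs)

  ∂x-cong : ∀ {n} (i : Fin n) → ∂x i Preserves _≈ₜ_ ⟶ _≈ₜ_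
  ∂x-cong i (coeff-≈ x≈y) = coeff-≈ (*-congˡ x≈y)

  scale-cong : ∀ {n} d → scale {n} d Preserves _≈ₜ_ ⟶ _≈ₜ_
  scale-cong d (coeff-≈ x≈y) = coeff-≈ (*-congˡ x≈y)

  mψ-cong : ∀ {n} (i : Fin n) → mψ i Preserves _≈ₜ_ ⟶ _≈ₜ_
  mψ-cong i (coeff-≈ {J = J} x≈y) with lookup J i
  ... | true  = ≈ₜ-refl
  ... | false = coeff-≈ (*-congˡ x≈y)

  ∂xs-cong : ∀ {n} (a : Vec ℕ n) → ∂xs a Preserves _≈ₜ_ ⟶ _≈ₜ_
  ∂xs-cong {n} a = foldr-cong (λ i → iter-cong (∂x-cong i) (lookup a i)) (allFin n)

  ∂x-intertwined : ∀ {n} (i : Fin n) → Intertwined (∂x i) (∂x i)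
  ∂x-intertwined i (x , a , J) = coeff-≈ (x∙yz≈y∙xz _ _ x)

  scale-intertwined : ∀ {n} d → Intertwined (scale {n} d) (scale d)
  scale-intertwined d (x , a , J) = coeff-≈ (x∙yz≈y∙xz d _ x)

  ∂θ-intertwined : ∀ {n} (i : Fin n) → Intertwined (∂θ i) (mψ i)
  ∂θ-intertwined i (x , a , J) with lookup J i in i∈J
  ... | true  rewrite lookup-map i not J | i∈J | map-[]≔ {x = false} not J i =
    coeff-≈ (sign-remove J i x i∈J)
  ... | false rewrite lookup-map i not J | i∈J = coeff-≈ (sym (zeroʳ _))

  ∂xs-intertwined : ∀ {n} (a : Vec ℕ n) → Intertwined (∂xs a) (∂xs a)
  ∂xs-intertwined {n} a =
    foldr-intertwined {F = ∂xᵃ} {∂xᵃ}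
      (λ i → iter-cong (∂x-cong i) (lookup a i))
      (λ i → iter-intertwined (∂x-cong i) (∂x-intertwined i) (lookup a i))
      (allFin n)
    where
    ∂xᵃ : Fin n → Term n → Term n
    ∂xᵃ i = iter (lookup a i) (∂x i)

  oddOps-intertwined : ∀ {n} (I : Subset n) → Intertwined (oddOps ∂θ I) (oddOps mψ I)
  oddOps-intertwined I = foldr-intertwined mψ-cong ∂θ-intertwined (members I)

  monomialAct : ∀ {n} → (Fin n → Term n → Term n) → Term n → Term n → Term n
  monomialAct op (c , a , I) t = scale (conj c) (∂xs a (oddOps op I t))

  monomialAct-intertwined : ∀ {n} (m : Term n) → Intertwined (monomialAct ∂θ m) (monomialAct mψ m)
  monomialAct-intertwined (c , a , I) =
    ∘-intertwined {F′ = ∂xs a ∘ oddOps ∂θ I} {G′ = ∂xs a ∘ oddOps mψ I}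
      (scale-cong (conj c)) (scale-intertwined (conj c))
      (∘-intertwined {F′ = oddOps ∂θ I} {G′ = oddOps mψ I}
        (∂xs-cong a) (∂xs-intertwined a) (oddOps-intertwined I))

  map-⋆-intertwined : ∀ {n} {F G : Term n → Term n} → Intertwined F G →
                      ∀ g → Pointwise _≈ₜ_ (map G (⋆ g)) (⋆ (map F g))
  map-⋆-intertwined F⋆G []      = []
  map-⋆-intertwined F⋆G (t ∷ g) = F⋆G t ∷ map-⋆-intertwined F⋆G g

  ⊙-⋆-pointwise : ∀ {n} (f g : Poly n) → Pointwise _≈ₜ_ (f ⊙ ⋆ g) (⋆ (f · g))
  ⊙-⋆-pointwise f g =
    ≡.subst (Pointwise _≈ₜ_ (f ⊙ ⋆ g)) (≡.sym (map-concatMap ⋆ₜ _ f))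
      (Pointwise.concat⁺ (Pointwise.map⁺ (λ m → map (monomialAct mψ m) (⋆ g))
                                          (λ m → ⋆ (map (monomialAct ∂θ m) g))
        (Pointwise.refl (λ {m} → map-⋆-intertwined (monomialAct-intertwined m) g) {f})))

  Pointwise⇒≋ : ∀ {n} {p q : Poly n} → Pointwise _≈ₜ_ p q → p ≋ q
  Pointwise⇒≋ []                    a J = refl
  Pointwise⇒≋ (coeff-≈ x≈y ∷ p≈q) a J = +-cong (if-cong _ x≈y) (Pointwise⇒≋ p≈q a J)
    where
    if-cong : ∀ b {x y} → x ≈ y → (if b then x else 0#) ≈ (if b then y else 0#)
    if-cong true  x≈y = x≈y
    if-cong false _   = refl

lemma4p9 : ∀ {c ℓ} (K : ConjField c ℓ) (n : ℕ) (f g : Super.Poly K n) →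
    Super._≋_ K (Super._⊙_ K f (Super.⋆ K g)) (Super.⋆ K (Super._·_ K f g))
lemma4p9 K n f g = Pointwise⇒≋ K (⊙-⋆-pointwise K f g)
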